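{- Let $G$ be a median graph with basepoint $v_0$. Let $u\in V$, let $L$ be a POF outgoing from $u$, let $Q$ be the hypercube with basis $u$ and signature $L$, and let $u^+$ be the anti-basis of $Q$. A vertex $v\neq u^+$ satisfies both $u\in I(v_0,v)$ and $L_{u,v}=L$ if and only if (i) $u^+\in I(v_0,v)$ and (ii) for each $E_j\in L_{u^+,v}$, the set $L\cup\{E_j\}$ is not a POF.
   Context: $G=(V,E)$ is a finite, simple, connected, undirected median graph: for all vertices $x,y,z$ the set $I(x,y)\cap I(y,z)\cap I(z,x)$ has exactly one element, where $I(u,v)=\{w: d(u,w)+d(w,v)=d(u,v)\}$. Edges $uv,xy$ are in relation $\Theta_0$ if $uvyx$ is a 4-cycle; $\Theta$ is the reflexive transitive closure of $\Theta_0$, with equivalence classes ($\Theta$-classes). For each class $E_i$, $(V,E\setminus E_i)$ has exactly two connected components (halfspaces). Classes $E_i,E_j$ are orthogonal if there is a 4-cycle $uvyx$ with $uv,xy\in E_i$, $ux,vy\in E_j$; a POF (pairwise orthogonal family) is a set of classes any two distinct members of which are orthogonal. A basepoint $v_0$ is fixed and each edge $xy$ is oriented from $x$ to $y$ when $d(v_0,x)<d(v_0,y)$. A POF $L$ is outgoing from $u$ if every class of $L$ has an edge oriented out of $u$; then there is a unique induced hypercube with basis $u$ (its vertex closest to $v_0$) whose edges have exactly the classes of $L$, called the hypercube with basis $u$ and signature $L$; its anti-basis is its vertex farthest from $v_0$. The signature $\sigma_{x,y}$ is the set of classes separating $x$ and $y$ (i.e. $x,y$ in different halfspaces). For $x\in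 I(v_0,y)$ the ladder set $L_{x,y}$ is the set of classes in $\sigma_{x,y}$ having an edge incident to $x$. -}

module Defs where

open import Data.Nat using (ℕ; zero; suc; _+_; _≤_; _<_)
open import Data.Fin using (Fin)
open import Data.Bool using (Bool; not)
open import Data.Vec using (Vec; _[_]%=_)
open import Data.Product using (Σ; ∃; ∃-syntax; _×_; _,_; proj₁; proj₂)
open import Data.Sum using (_⊎_)
open import Relation.Nullary using (¬_)
open import Relation.Binary.PropositionalEquality using (_≡_; _≢_)
open import Relation.Binary.Construct.Closure.ReflexiveTransitive using (Star)
open import Function.Bundles using (_⇔_)

module _ {n : ℕ} (Adj : Fin n → Fin n → Set) where

  V : Set
  V = Fin n

  data Walk : V → V → ℕ → Set where
    here : ∀ {x} → Walk x x zero
    step : ∀ {x y z k} → Adj x y → Walk y z k → Walk x z (suc k)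

  Dist : V → V → ℕ → Set
  Dist x y k = Walk x y k × (∀ m → Walk x y m → k ≤ m)

  InI : V → V → V → Set
  InI u v w = ∃[ a ] ∃[ b ] (Dist u w a × Dist w v b × Dist u v (a + b))

  IsMedianGraph : Set
  IsMedianGraph =
      (∀ x → ¬ Adj x x)
    × (∀ x y → Adj x y → Adj y x)
    × (∀ x y → ∃[ k ] Walk x y k)
    × (∀ x y z → ∃[ m ] ((InI x y m × InI y z m × InI z x m)
         × (∀ m' → (InI x y m' × InI y z m' × InI z x m') → m' ≡ m)))

  Cycle4 : V → V → V → V → Set
  Cycle4 a b c d = Adj a b × Adj b c × Adj c d × Adj d a × a ≢ c × b ≢ d

  -- edges are represented by ordered vertex pairs (p , q) with Adj p q;
  -- (p , q) and (q , p) represent the same undirected edge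
  Pair : Set
  Pair = V × V

  IsEdge : Pair → Set
  IsEdge (p , q) = Adj p q

  data Θstep : Pair → Pair → Set where
    θ₀   : ∀ {u v x y} → Cycle4 u v y x → Θstep (u , v) (x , y)
    flip : ∀ {u v} → Adj u v → Θstep (u , v) (v , u)

  Θ : Pair → Pair → Set
  Θ = Star Θstep

  -- A set of Θ-classes is represented by its union: a Θ-saturated set of edges.
  IsClassSet : (Pair → Set) → Set
  IsClassSet L = (∀ e → L e → IsEdge e) × (∀ e f → Θ e f → L e → L f)

  Orth : Pair → Pair → Set
  Orth e f = ∃[ u ] ∃[ v ] ∃[ y ] ∃[ x ]
    (Cycle4 u v y x × Θ e (u , v) × Θ e (x , y) × Θ f (u , x) × Θ f (v , y))

  IsPOF : (Pair → Set) → Set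
  IsPOF L = ∀ e f → L e → L f → ¬ Θ e f → Orth e f

  OrientedFrom : V → V → V → Set
  OrientedFrom v₀ x y = ∃[ i ] ∃[ j ] (Dist v₀ x i × Dist v₀ y j × i < j)

  Outgoing : V → V → (Pair → Set) → Set
  Outgoing v₀ u L = ∀ e → L e → ∃[ w ] (Adj u w × Θ e (u , w) × OrientedFrom v₀ u w)

  CubeAdj : ∀ {k} → Vec Bool k → Vec Bool k → Set
  CubeAdj {k} a b = ∃[ i ] (b ≡ a [ i ]%= not)

  IsInducedCube : ∀ {k} → (Vec Bool k → V) → Set
  IsInducedCube φ = (∀ a b → φ a ≡ φ b → a ≡ b)
                  × (∀ a b → Adj (φ a) (φ b) ⇔ CubeAdj a b)

  CubeSignature : ∀ {k} → (Vec Bool k → V) → (Pair → Set) → Set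
  CubeSignature φ L = ∀ e → L e ⇔ (∃[ a ] ∃[ b ] (CubeAdj a b × Θ e (φ a , φ b)))

  IsBasis : ∀ {k} → V → (Vec Bool k → V) → Vec Bool k → Set
  IsBasis v₀ φ a = ∀ b i j → Dist v₀ (φ a) i → Dist v₀ (φ b) j → i ≤ j

  IsAntiBasis : ∀ {k} → V → (Vec Bool k → V) → Vec Bool k → Set
  IsAntiBasis v₀ φ a = ∀ b i j → Dist v₀ (φ b) i → Dist v₀ (φ a) j → i ≤ j

  IsHypercubeWith : ∀ {k} → V → V → (Pair → Set) → (Vec Bool k → V) → Set
  IsHypercubeWith v₀ u L φ =
    IsInducedCube φ × CubeSignature φ L × ∃[ a ] (φ a ≡ u × IsBasis v₀ φ a)

  data ConnAvoid (e : Pair) : V → V → Set where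
    here : ∀ {x} → ConnAvoid e x x
    step : ∀ {x y z} → Adj x y → ¬ Θ e (x , y) → ConnAvoid e y z → ConnAvoid e x z

  InSignature : V → V → Pair → Set
  InSignature x y e = IsEdge e × ¬ ConnAvoid e x y

  InLadder : V → V → Pair → Set
  InLadder x y e = InSignature x y e × ∃[ w ] (Adj x w × Θ e (x , w))

{-# OPTIONS --safe #-}
-- An edge ab splits the vertices into those closer to a and those closer to b. Θ-related edges
-- induce the same split, and conversely every edge crossing the split of ab is Θ-related to ab.
-- Hence w ∈ I(x,y) iff no edge separates w from both x and y, and σ_{x,y} consists of the
-- classes whose split separates x and y. The classes separating u from u⁺ are exactly those of L,
-- and v₀ lies on the side of u for each of them; this yields the two interval conditions.
-- For the ladder sets: a class of L_{u⁺,v} outside L that is orthogonal to L can be carried along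
-- the cube, by completing squares at each cube vertex, to an edge at u, so it would lie in L_{u,v};
-- conversely a class of L_{u,v} outside L spans a square with every cube edge at u, hence is
-- orthogonal to L and reappears at u⁺, so L ∪ {it} would be a POF.
module Submission where

open import Defs
open import Data.Nat using (ℕ; zero; suc; _+_; _≤_; _<_; z≤n; s≤s; _<ᵇ_)
open import Data.Nat.Properties hiding (_≟_)
open import Data.Fin using (Fin; zero; suc)
open import Data.Fin.Properties using () renaming (_≟_ to _≟ᶠ_)
open import Data.Bool using (Bool; true; false; not; _xor_; T; _≟_)
open import Data.Bool.Properties using (not-involutive; not-¬; ¬-not; xor-comm; xor-annihilates-not)
open import Data.Vec using (Vec; []; _∷_; lookup; _[_]%=_)
open import Data.Vec.Properties
  using (updateAt-updateAt; updateAt-cong; updateAt-id; updateAt-commutes; lookup∘updateAt; lookup∘updateAt′)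
open import Data.Product using (∃-syntax; _×_; _,_; proj₁; proj₂)
open import Data.Sum using (_⊎_; inj₁; inj₂)
open import Data.Empty using (⊥; ⊥-elim)
open import Relation.Nullary using (¬_; Dec; yes; no)
open import Relation.Binary.PropositionalEquality
open import Relation.Binary.Construct.Closure.ReflexiveTransitive using (ε; _◅_; _◅◅_; reverse)
open import Function.Base using (_∘_)
open import Function.Bundles using (Equivalence; _⇔_; mk⇔)

flipAt : ∀ {k} → Fin k → Vec Bool k → Vec Bool k
flipAt i b = b [ i ]%= not

module _ {k : ℕ} where

  flipAt-involutive : ∀ i (b : Vec Bool k) → flipAt i (flipAt i b) ≡ b
  flipAt-involutive i b =
    trans (updateAt-updateAt i b) (trans (updateAt-cong i not-involutive b) (updateAt-id i b))

  flipAt-comm : ∀ {i j} → i ≢ j → (b : Vec Bool k) → flipAt i (flipAt j b) ≡ flipAt j (flipAt i b)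
  flipAt-comm = updateAt-commutes _ _

  flipAt-≢-flipAt : ∀ {i j} → i ≢ j → (b : Vec Bool k) → flipAt i b ≢ flipAt j b
  flipAt-≢-flipAt {i} {j} i≢j b eq = not-¬ refl (begin
    lookup b i               ≡⟨ lookup∘updateAt′ i j i≢j b ⟨
    lookup (flipAt j b) i    ≡⟨ cong (λ c → lookup c i) eq ⟨
    lookup (flipAt i b) i    ≡⟨ lookup∘updateAt i b ⟩
    not (lookup b i)         ∎)
    where open ≡-Reasoning

  ≢-flipAt-flipAt : ∀ {i j} → i ≢ j → (b : Vec Bool k) → b ≢ flipAt j (flipAt i b)
  ≢-flipAt-flipAt {i} {j} i≢j b eq = not-¬ refl (begin
    lookup b i                         ≡⟨ cong (λ c → lookup c i) eq ⟩
    lookup (flipAt j (flipAt i b)) i   ≡⟨ lookup∘updateAt′ i j i≢j (flipAt i b) ⟩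
    lookup (flipAt i b) i              ≡⟨ lookup∘updateAt i b ⟩
    not (lookup b i)                   ∎)
    where open ≡-Reasoning

flipAt-induction : ∀ {k} (P : Vec Bool k → Set) → (∀ b i → P b → P (flipAt i b)) →
                   ∀ b c → P b → P c
flipAt-induction {zero}  P closed [] [] p = p
flipAt-induction {suc k} P closed (x ∷ b) (y ∷ c) p
  with flipAt-induction (λ t → P (x ∷ t)) (λ t i → closed (x ∷ t) (suc i)) b c p
     | x ≟ y
... | q | yes refl = q
... | q | no x≢y   = subst (λ z → P (z ∷ c)) (sym (¬-not (x≢y ∘ sym))) (closed (x ∷ c) zero q)

≢-both⇒≡ : ∀ {b c e : Bool} → b ≢ c → b ≢ e → c ≡ e
≢-both⇒≡ b≢c b≢e = trans (¬-not (λ eq → b≢c (sym eq))) (sym (¬-not (λ eq → b≢e (sym eq))))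

xor-cancelʳ : ∀ x y a → x xor a ≡ y xor a → x ≡ y
xor-cancelʳ true  true  _ _ = refl
xor-cancelʳ false false _ _ = refl
xor-cancelʳ true  false a eq = ⊥-elim (not-¬ refl (sym eq))
xor-cancelʳ false true  a eq = ⊥-elim (not-¬ refl eq)

xor-cancelˡ : ∀ a x y → a xor x ≡ a xor y → x ≡ y
xor-cancelˡ a x y eq = xor-cancelʳ x y a (trans (xor-comm x a) (trans eq (xor-comm a y)))

n+n≡2⇒n≡1 : ∀ n → n + n ≡ 2 → n ≡ 1
n+n≡2⇒n≡1 (suc zero)    _  = refl
n+n≡2⇒n≡1 (suc (suc n)) eq with trans (sym (+-suc n (suc n))) (suc-injective (suc-injective eq))
... | ()

module MedianGraph {n : ℕ} (Adj : Fin n → Fin n → Set) (median : IsMedianGraph Adj) where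

  Vertex : Set
  Vertex = Fin n

  Adj-irrefl : ∀ x → ¬ Adj x x
  Adj-irrefl = proj₁ median

  Adj-sym : ∀ {x y} → Adj x y → Adj y x
  Adj-sym = proj₁ (proj₂ median) _ _

  _++ʷ_ : ∀ {x y z i j} → Walk Adj x y i → Walk Adj y z j → Walk Adj x z (i + j)
  here       ++ʷ q = q
  step xy p  ++ʷ q = step xy (p ++ʷ q)

  reverseʷ : ∀ {x y i} → Walk Adj x y i → Walk Adj y x i
  reverseʷ here = here
  reverseʷ {i = suc i} (step xy p) = subst (Walk Adj _ _) (+-comm i 1) (reverseʷ p ++ʷ step (Adj-sym xy) here)

  IsMedianOf : Vertex → Vertex → Vertex → Vertex → Set
  IsMedianOf x y z m = InI Adj x y m × InI Adj y z m × InI Adj z x m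

  median-axiom : ∀ x y z → ∃[ m ] (IsMedianOf x y z m × (∀ m′ → IsMedianOf x y z m′ → m′ ≡ m))
  median-axiom = proj₂ (proj₂ (proj₂ median))

  -- The median of x, y, y lies in I(x,y), and membership in I(x,y) carries a geodesic.
  private
    interval-witness : ∀ x y → InI Adj x y (proj₁ (median-axiom x y y))
    interval-witness x y = proj₁ (proj₁ (proj₂ (median-axiom x y y)))

  d : Vertex → Vertex → ℕ
  d x y = proj₁ (interval-witness x y) + proj₁ (proj₂ (interval-witness x y))

  d-Dist : ∀ x y → Dist Adj x y (d x y)
  d-Dist x y = proj₂ (proj₂ (proj₂ (proj₂ (interval-witness x y))))

  geodesic : ∀ x y → Walk Adj x y (d x y)
  geodesic x y = proj₁ (d-Dist x y)

  d-minimal : ∀ {x y k} → Walk Adj x y k → d x y ≤ k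
  d-minimal = proj₂ (d-Dist _ _) _

  Dist⇒≡d : ∀ {x y k} → Dist Adj x y k → k ≡ d x y
  Dist⇒≡d {x} {y} D = ≤-antisym (proj₂ D _ (geodesic x y)) (d-minimal (proj₁ D))

  d-triangle : ∀ x y z → d x z ≤ d x y + d y z
  d-triangle x y z = d-minimal (geodesic x y ++ʷ geodesic y z)

  d-sym : ∀ x y → d x y ≡ d y x
  d-sym x y = ≤-antisym (d-minimal (reverseʷ (geodesic y x))) (d-minimal (reverseʷ (geodesic x y)))

  d≡0⇒≡ : ∀ {x y} → d x y ≡ 0 → x ≡ y
  d≡0⇒≡ {x} {y} d≡0 with subst (Walk Adj x y) d≡0 (geodesic x y)
  ... | here = refl

  d-refl : ∀ x → d x x ≡ 0
  d-refl x = n≤0⇒n≡0 (d-minimal here)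

  d≡1⇒Adj : ∀ {x y} → d x y ≡ 1 → Adj x y
  d≡1⇒Adj {x} {y} d≡1 with subst (Walk Adj x y) d≡1 (geodesic x y)
  ... | step xy here = xy

  Adj⇒d≡1 : ∀ {x y} → Adj x y → d x y ≡ 1
  Adj⇒d≡1 {x} {y} xy with d x y in eq
  ... | zero        = ⊥-elim (Adj-irrefl x (subst (Adj x) (sym (d≡0⇒≡ eq)) xy))
  ... | suc zero    = refl
  ... | suc (suc k) = ⊥-elim (<⇒≱ (s≤s (s≤s z≤n)) (subst (_≤ 1) eq (d-minimal (step xy here))))

  Adj⇒d≡1′ : ∀ {x y} → Adj x y → d y x ≡ 1
  Adj⇒d≡1′ xy = Adj⇒d≡1 (Adj-sym xy)

  d-step-≤ : ∀ {p q} w → Adj p q → d w q ≤ suc (d w p)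
  d-step-≤ {p} {q} w pq =
    subst (d w q ≤_) (trans (cong (d w p +_) (Adj⇒d≡1 pq)) (+-comm (d w p) 1)) (d-triangle w p q)

  d-step-≤′ : ∀ {p q} w → Adj p q → d q w ≤ suc (d p w)
  d-step-≤′ {p} {q} w pq = subst₂ _≤_ (d-sym w q) (cong suc (d-sym w p)) (d-step-≤ w pq)

  step-toward : ∀ {x y k} → d x y ≡ suc k → ∃[ x′ ] (Adj x x′ × d x′ y ≡ k)
  step-toward {x} {y} {k} eq with subst (Walk Adj x y) eq (geodesic x y)
  ... | step {y = x′} xx′ w = x′ , xx′ , ≤-antisym (d-minimal w)
          (≤-pred (subst (_≤ suc (d x′ y)) eq (d-minimal (step xx′ (geodesic x′ y)))))

  Between : Vertex → Vertex → Vertex → Set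
  Between x w y = d x w + d w y ≡ d x y

  InI⇒Between : ∀ {x y w} → InI Adj x y w → Between x w y
  InI⇒Between (_ , _ , Dxw , Dwy , Dxy) =
    trans (cong₂ _+_ (sym (Dist⇒≡d Dxw)) (sym (Dist⇒≡d Dwy))) (Dist⇒≡d Dxy)

  Between⇒InI : ∀ {x y w} → Between x w y → InI Adj x y w
  Between⇒InI {x} {y} {w} eq = d x w , d w y , d-Dist x w , d-Dist w y , subst (Dist Adj x y) (sym eq) (d-Dist x y)

  Between-sym : ∀ {x w y} → Between x w y → Between y w x
  Between-sym {x} {w} {y} eq = begin
    d y w + d w x   ≡⟨ cong₂ _+_ (d-sym y w) (d-sym w x) ⟩
    d w y + d x w   ≡⟨ +-comm (d w y) (d x w) ⟩
    d x w + d w y   ≡⟨ eq ⟩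
    d x y           ≡⟨ d-sym x y ⟩
    d y x           ∎
    where open ≡-Reasoning

  Between-by-distances : ∀ {x w y i j k} → d x w ≡ i → d w y ≡ j → d x y ≡ k → i + j ≡ k → Between x w y
  Between-by-distances refl refl refl eq = eq

  med : Vertex → Vertex → Vertex → Vertex
  med x y z = proj₁ (median-axiom x y z)

  med-between₁ : ∀ x y z → Between x (med x y z) y
  med-between₁ x y z = InI⇒Between (proj₁ (proj₁ (proj₂ (median-axiom x y z))))

  med-between₂ : ∀ x y z → Between y (med x y z) z
  med-between₂ x y z = InI⇒Between (proj₁ (proj₂ (proj₁ (proj₂ (median-axiom x y z)))))

  med-between₃ : ∀ x y z → Between z (med x y z) x
  med-between₃ x y z = InI⇒Between (proj₂ (proj₂ (proj₁ (proj₂ (median-axiom x y z)))))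

  med-unique : ∀ {x y z m} → Between x m y → Between y m z → Between z m x → m ≡ med x y z
  med-unique {x} {y} {z} {m} b₁ b₂ b₃ =
    proj₂ (proj₂ (median-axiom x y z)) m (Between⇒InI b₁ , Between⇒InI b₂ , Between⇒InI b₃)

  between-neighbours : ∀ {a b m} → Adj a b → Between a m b → m ≡ a ⊎ m ≡ b
  between-neighbours {a} {b} {m} ab eq with d a m in eq′
  ... | zero        = inj₁ (sym (d≡0⇒≡ eq′))
  ... | suc zero    = inj₂ (d≡0⇒≡ (+-cancelˡ-≡ 1 _ _ (trans eq (Adj⇒d≡1 ab))))
  ... | suc (suc k) = ⊥-elim (<⇒≱ (s≤s (s≤s z≤n)) (≤-reflexive (trans eq (Adj⇒d≡1 ab))))

  Adj⇒d-suc : ∀ {a b} → Adj a b → ∀ w → d w b ≡ suc (d w a) ⊎ d w a ≡ suc (d w b)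
  Adj⇒d-suc {a} {b} ab w with between-neighbours ab (med-between₁ a b w)
  ... | inj₁ m≡a = inj₁ (begin
    d w b                  ≡⟨ d-sym w b ⟩
    d b w                  ≡⟨ subst (λ m → d b m + d m w ≡ d b w) m≡a (med-between₂ a b w) ⟨
    d b a + d a w          ≡⟨ cong₂ _+_ (Adj⇒d≡1′ ab) (d-sym a w) ⟩
    suc (d w a)            ∎)
    where open ≡-Reasoning
  ... | inj₂ m≡b = inj₂ (begin
    d w a                  ≡⟨ subst (λ m → d w m + d m a ≡ d w a) m≡b (med-between₃ a b w) ⟨
    d w b + d b a          ≡⟨ cong (d w b +_) (Adj⇒d≡1′ ab) ⟩
    d w b + 1              ≡⟨ +-comm (d w b) 1 ⟩
    suc (d w b)            ∎)
    where open ≡-Reasoning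

  Adj⇒d≢ : ∀ {a b} → Adj a b → ∀ w → d w a ≢ d w b
  Adj⇒d≢ ab w eq with Adj⇒d-suc ab w
  ... | inj₁ e = 1+n≢n (trans (sym e) (sym eq))
  ... | inj₂ e = 1+n≢n (trans (sym e) eq)

  d≡2 : ∀ {x y z} → Adj x z → Adj z y → x ≢ y → ¬ Adj x y → d x y ≡ 2
  d≡2 {x} {y} {z} xz zy x≢y ¬xy with d x y in eq
  ... | zero                = ⊥-elim (x≢y (d≡0⇒≡ eq))
  ... | suc zero            = ⊥-elim (¬xy (d≡1⇒Adj eq))
  ... | suc (suc zero)      = refl
  ... | suc (suc (suc k))   = ⊥-elim (<⇒≱ (s≤s (s≤s (s≤s z≤n)))
                                (subst₂ _≤_ eq (cong₂ _+_ (Adj⇒d≡1 xz) (Adj⇒d≡1 zy)) (d-triangle x z y)))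

  distinct-neighbours-d≡2 : ∀ {x p q} → Adj x p → Adj x q → p ≢ q → d p q ≡ 2
  distinct-neighbours-d≡2 {x} xp xq p≢q =
    d≡2 (Adj-sym xp) xq p≢q (λ pq → Adj⇒d≢ pq x (trans (Adj⇒d≡1 xp) (sym (Adj⇒d≡1 xq))))

  common-neighbour-is-median : ∀ {v x z w} → Adj v z → Adj z x → d v x ≡ 2 →
                               d w v ≡ suc (d w z) → d w x ≡ suc (d w z) → z ≡ med v x w
  common-neighbour-is-median {v} {x} {z} {w} vz zx dvx dwv dwx = med-unique
    (Between-by-distances (Adj⇒d≡1 vz) (Adj⇒d≡1 zx) dvx refl)
    (Between-by-distances (Adj⇒d≡1′ zx) (d-sym z w) (trans (d-sym x w) dwx) refl)
    (Between-by-distances refl (Adj⇒d≡1′ vz) dwv (+-comm (d w z) 1))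

  side : Vertex × Vertex → Vertex → Bool
  side (a , b) w = d w a <ᵇ d w b

  Separates : Vertex × Vertex → Vertex → Vertex → Set
  Separates e p q = side e p ≢ side e q

  ¬Separates⇒≡ : ∀ {e p q} → ¬ Separates e p q → side e p ≡ side e q
  ¬Separates⇒≡ {e} {p} {q} ¬sep with side e p ≟ side e q
  ... | yes eq = eq
  ... | no neq = ⊥-elim (¬sep neq)

  side-true : ∀ {a b w} → d w a < d w b → side (a , b) w ≡ true
  side-true {a} {b} {w} lt with d w a <ᵇ d w b in eq
  ... | true  = refl
  ... | false = ⊥-elim (subst T eq (<⇒<ᵇ lt))

  side-false : ∀ {a b w} → d w b < d w a → side (a , b) w ≡ false
  side-false {a} {b} {w} lt with d w a <ᵇ d w b in eq
  ... | false = refl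
  ... | true  = ⊥-elim (<⇒≯ lt (<ᵇ⇒< (d w a) (d w b) (subst T (sym eq) _)))

  side-true⇒d : ∀ {a b w} → Adj a b → side (a , b) w ≡ true → d w b ≡ suc (d w a)
  side-true⇒d {a} {b} {w} ab s with Adj⇒d-suc ab w
  ... | inj₁ eq = eq
  ... | inj₂ eq with trans (sym s) (side-false {a} {b} {w} (≤-reflexive (sym eq)))
  ...   | ()

  side-false⇒d : ∀ {a b w} → Adj a b → side (a , b) w ≡ false → d w a ≡ suc (d w b)
  side-false⇒d {a} {b} {w} ab s with Adj⇒d-suc ab w
  ... | inj₂ eq = eq
  ... | inj₁ eq with trans (sym s) (side-true {a} {b} {w} (≤-reflexive (sym eq)))
  ...   | ()

  side-swap : ∀ {a b} → Adj a b → ∀ w → side (b , a) w ≡ not (side (a , b) w)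
  side-swap {a} {b} ab w with Adj⇒d-suc ab w
  ... | inj₁ eq rewrite side-true {a} {b} {w} (≤-reflexive (sym eq)) = side-false {b} {a} {w} (≤-reflexive (sym eq))
  ... | inj₂ eq rewrite side-false {a} {b} {w} (≤-reflexive (sym eq)) = side-true {b} {a} {w} (≤-reflexive (sym eq))

  side-source : ∀ {a b} → Adj a b → side (a , b) a ≡ true
  side-source {a} {b} ab = side-true {a} {b} {a} (subst₂ _<_ (sym (d-refl a)) (sym (Adj⇒d≡1 ab)) (s≤s z≤n))

  side-target : ∀ {a b} → Adj a b → side (a , b) b ≡ false
  side-target {a} {b} ab = side-false {a} {b} {b} (subst₂ _<_ (sym (d-refl b)) (sym (Adj⇒d≡1′ ab)) (s≤s z≤n))

  edge-separates : ∀ {a b} → Adj a b → Separates (a , b) a b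
  edge-separates ab eq with trans (sym (side-source ab)) (trans eq (side-target ab))
  ... | ()

  Cycle4-sym : ∀ {u v y x} → Cycle4 Adj u v y x → Cycle4 Adj v u x y
  Cycle4-sym (uv , vy , yx , xu , u≢y , v≢x) = Adj-sym uv , Adj-sym xu , Adj-sym yx , Adj-sym vy , v≢x , u≢y

  Cycle4-reverse : ∀ {u v y x} → Cycle4 Adj u v y x → Cycle4 Adj x y v u
  Cycle4-reverse (uv , vy , yx , xu , u≢y , v≢x) =
    Adj-sym yx , Adj-sym vy , Adj-sym uv , Adj-sym xu , (λ eq → v≢x (sym eq)) , (λ eq → u≢y (sym eq))

  Cycle4-transpose : ∀ {u v y x} → Cycle4 Adj u v y x → Cycle4 Adj u x y v
  Cycle4-transpose (uv , vy , yx , xu , u≢y , v≢x) =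
    Adj-sym xu , Adj-sym yx , Adj-sym vy , Adj-sym uv , u≢y , (λ eq → v≢x (sym eq))

  -- Both u and y would be the median of v, x and w.
  Cycle4-¬crossing : ∀ {u v y x w} → Cycle4 Adj u v y x →
                     side (u , v) w ≡ true → side (x , y) w ≡ false → ⊥
  Cycle4-¬crossing {u} {v} {y} {x} {w} (uv , vy , yx , xu , u≢y , v≢x) s₁ s₂ =
    u≢y (trans (common-neighbour-is-median (Adj-sym uv) (Adj-sym xu) dvx dwv dwx′)
          (sym (common-neighbour-is-median vy yx dvx dwv′ dwx)))
    where
    dwv : d w v ≡ suc (d w u)
    dwv = side-true⇒d uv s₁
    dwx : d w x ≡ suc (d w y)
    dwx = side-false⇒d (Adj-sym yx) s₂
    dwu≡dwy : d w u ≡ d w y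
    dwu≡dwy = ≤-antisym (≤-pred (subst (_≤ suc (d w y)) dwv (d-step-≤ w (Adj-sym vy))))
                        (≤-pred (subst (_≤ suc (d w u)) dwx (d-step-≤ w (Adj-sym xu))))
    dwv′ : d w v ≡ suc (d w y)
    dwv′ = trans dwv (cong suc dwu≡dwy)
    dwx′ : d w x ≡ suc (d w u)
    dwx′ = trans dwx (cong suc (sym dwu≡dwy))
    dvx : d v x ≡ 2
    dvx = d≡2 (Adj-sym uv) (Adj-sym xu) v≢x (λ vx → Adj⇒d≢ vx w (trans dwv (sym dwx′)))

  Cycle4-side : ∀ {u v y x} → Cycle4 Adj u v y x → ∀ w → side (x , y) w ≡ side (u , v) w
  Cycle4-side {u} {v} {y} {x} c w with side (u , v) w in s₁ | side (x , y) w in s₂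
  ... | true  | true  = refl
  ... | false | false = refl
  ... | true  | false = ⊥-elim (Cycle4-¬crossing c s₁ s₂)
  ... | false | true  = ⊥-elim (Cycle4-¬crossing (Cycle4-sym c)
                          (trans (side-swap (proj₁ c) w) (cong not s₁))
                          (trans (side-swap (Adj-sym (proj₁ (proj₂ (proj₂ c)))) w) (cong not s₂)))

  SameCut : Vertex × Vertex → Vertex × Vertex → Set
  SameCut e f = (∀ w → side f w ≡ side e w) ⊎ (∀ w → side f w ≡ not (side e w))

  SameCut-trans : ∀ {e f g} → SameCut e f → SameCut f g → SameCut e g
  SameCut-trans (inj₁ p) (inj₁ q) = inj₁ (λ w → trans (q w) (p w))
  SameCut-trans (inj₁ p) (inj₂ q) = inj₂ (λ w → trans (q w) (cong not (p w)))
  SameCut-trans (inj₂ p) (inj₁ q) = inj₂ (λ w → trans (q w) (p w))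
  SameCut-trans (inj₂ p) (inj₂ q) = inj₁ (λ w → trans (q w) (trans (cong not (p w)) (not-involutive _)))

  Θ⇒SameCut : ∀ {e f} → Θ Adj e f → SameCut e f
  Θ⇒SameCut ε              = inj₁ (λ _ → refl)
  Θ⇒SameCut (θ₀ c ◅ r)     = SameCut-trans (inj₁ (Cycle4-side c)) (Θ⇒SameCut r)
  Θ⇒SameCut (flip ab ◅ r)  = SameCut-trans (inj₂ (side-swap ab)) (Θ⇒SameCut r)

  Θ-sym : ∀ {e f} → Θ Adj e f → Θ Adj f e
  Θ-sym = reverse λ where
    (θ₀ c)   → θ₀ (Cycle4-reverse c)
    (flip ab) → flip (Adj-sym ab)

  Θ-resp-≡side : ∀ {e f p q} → Θ Adj e f → side e p ≡ side e q → side f p ≡ side f q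
  Θ-resp-≡side {p = p} {q} θ eq with Θ⇒SameCut θ
  ... | inj₁ h = trans (h p) (trans eq (sym (h q)))
  ... | inj₂ h = trans (h p) (trans (cong not eq) (sym (h q)))

  Θ-resp-Separates : ∀ {e f p q} → Θ Adj e f → Separates e p q → Separates f p q
  Θ-resp-Separates θ sep eq = sep (Θ-resp-≡side (Θ-sym θ) eq)

  Θ-edge-separates : ∀ {e x y} → Θ Adj e (x , y) → Adj x y → Separates e x y
  Θ-edge-separates θ xy = Θ-resp-Separates (Θ-sym θ) (edge-separates xy)

  crossing-edge-d : ∀ {a b x y} → Adj a b → Adj x y → side (a , b) x ≡ true → side (a , b) y ≡ false →
                    d y b ≡ d x a
  crossing-edge-d {a} {b} {x} {y} ab xy sx sy = ≤-antisym
    (≤-pred (subst (_≤ suc (d x a)) (side-false⇒d ab sy) (d-step-≤′ a xy)))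
    (≤-pred (subst (_≤ suc (d y b)) (side-true⇒d ab sx) (d-step-≤′ b (Adj-sym xy))))

  median-of-equidistant-pair : ∀ {p q b k} → d p q ≡ 2 → d p b ≡ suc k → d q b ≡ suc k →
                     d p (med p q b) ≡ 1 × d (med p q b) q ≡ 1 × d (med p q b) b ≡ k
  median-of-equidistant-pair {p} {q} {b} {k} dpq dpb dqb = A≡1 , B≡1 , C≡k
    where
    m : Vertex
    m = med p q b
    A B C : ℕ
    A = d p m
    B = d m q
    C = d m b
    A+B : A + B ≡ 2
    A+B = trans (med-between₁ p q b) dpq
    B+C : B + C ≡ suc k
    B+C = trans (cong (_+ C) (d-sym m q)) (trans (med-between₂ p q b) dqb)
    A+C : A + C ≡ suc k
    A+C = begin
      A + C       ≡⟨ +-comm A C ⟩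
      C + A       ≡⟨ cong₂ _+_ (d-sym m b) (d-sym p m) ⟩
      d b m + d m p ≡⟨ med-between₃ p q b ⟩
      d b p       ≡⟨ d-sym b p ⟩
      d p b       ≡⟨ dpb ⟩
      suc k       ∎
      where open ≡-Reasoning
    B≡A : B ≡ A
    B≡A = +-cancelʳ-≡ C B A (trans B+C (sym A+C))
    A≡1 : A ≡ 1
    A≡1 = n+n≡2⇒n≡1 A (trans (cong (A +_) (sym B≡A)) A+B)
    B≡1 : B ≡ 1
    B≡1 = trans B≡A A≡1
    C≡k : C ≡ k
    C≡k = suc-injective (trans (cong (_+ C) (sym B≡1)) B+C)

  -- x′ is the next vertex on a geodesic from x to a, and m is the median of x′, y and b.
  crossing-square : ∀ {a b x y k} → Adj a b → Adj x y → side (a , b) x ≡ true → side (a , b) y ≡ false →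
                    d x a ≡ suc k →
                    ∃[ x′ ] ∃[ m ] (Cycle4 Adj x′ m y x × d x′ a ≡ k
                                    × side (a , b) x′ ≡ true × side (a , b) m ≡ false)
  crossing-square {a} {b} {x} {y} {k} ab xy sx sy dxa =
    x′ , m , (x′m , my , Adj-sym xy , xx′ , x′≢y , m≢x) , dx′a , sx′ , sm
    where
    x′ : Vertex
    x′ = proj₁ (step-toward dxa)
    xx′ : Adj x x′
    xx′ = proj₁ (proj₂ (step-toward dxa))
    dx′a : d x′ a ≡ k
    dx′a = proj₂ (proj₂ (step-toward dxa))
    dyb : d y b ≡ suc k
    dyb = trans (crossing-edge-d ab xy sx sy) dxa
    dxb : d x b ≡ suc (suc k)
    dxb = trans (side-true⇒d ab sx) (cong suc dxa)
    dya : d y a ≡ suc (suc k)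
    dya = trans (side-false⇒d ab sy) (cong suc dyb)
    dx′b : d x′ b ≡ suc k
    dx′b = ≤-antisym (subst (λ j → d x′ b ≤ suc j) dx′a (d-step-≤ x′ ab))
                     (≤-pred (subst (_≤ suc (d x′ b)) dxb (d-step-≤′ b (Adj-sym xx′))))
    dx′y : d x′ y ≡ 2
    dx′y = ≤-antisym
      (subst (d x′ y ≤_) (cong₂ _+_ (Adj⇒d≡1′ xx′) (Adj⇒d≡1 xy)) (d-triangle x′ x y))
      (+-cancelʳ-≤ k 2 (d x′ y) (subst₂ _≤_ dya (cong₂ _+_ (d-sym y x′) dx′a) (d-triangle y x′ a)))
    m : Vertex
    m = med x′ y b
    near : d x′ m ≡ 1 × d m y ≡ 1 × d m b ≡ k
    near = median-of-equidistant-pair dx′y dx′b dyb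
    x′m : Adj x′ m
    x′m = d≡1⇒Adj (proj₁ near)
    my : Adj m y
    my = d≡1⇒Adj (proj₁ (proj₂ near))
    dma : d m a ≡ suc k
    dma = ≤-antisym (subst (λ j → d m a ≤ suc j) dx′a (d-step-≤′ a x′m))
                    (≤-pred (subst (_≤ suc (d m a)) dya (d-step-≤′ a my)))
    sx′ : side (a , b) x′ ≡ true
    sx′ = side-true (subst₂ _<_ (sym dx′a) (sym dx′b) ≤-refl)
    sm : side (a , b) m ≡ false
    sm = side-false (subst₂ _<_ (sym (proj₂ (proj₂ near))) (sym dma) ≤-refl)
    x′≢y : x′ ≢ y
    x′≢y refl = 0≢1+n (trans (sym (d-refl x′)) dx′y)
    m≢x : m ≢ x
    m≢x eq = m≢1+n+m k (trans (sym (proj₂ (proj₂ near))) (trans (cong (λ t → d t b) eq) dxb))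

  crossing-edge-Θ : ∀ {a b x y} → Adj a b → Adj x y → side (a , b) x ≡ true → side (a , b) y ≡ false →
                    Θ Adj (a , b) (x , y)
  crossing-edge-Θ {a} {b} ab = by-distance (d _ a) refl
    where
    by-distance : ∀ k {x y} → d x a ≡ k → Adj x y → side (a , b) x ≡ true → side (a , b) y ≡ false →
                  Θ Adj (a , b) (x , y)
    by-distance zero {x} {y} dxa xy sx sy =
      subst₂ (λ p q → Θ Adj (a , b) (p , q))
             (sym (d≡0⇒≡ dxa)) (sym (d≡0⇒≡ (trans (crossing-edge-d ab xy sx sy) dxa))) ε
    by-distance (suc k) dxa xy sx sy with crossing-square ab xy sx sy dxa
    ... | x′ , m , c , dx′a , sx′ , sm = by-distance k dx′a (proj₁ c) sx′ sm ◅◅ (θ₀ c ◅ ε)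

  separating-edge-Θ : ∀ {a b x y} → Adj a b → Adj x y → Separates (a , b) x y → Θ Adj (a , b) (x , y)
  separating-edge-Θ {a} {b} {x} {y} ab xy sep with side (a , b) x in sx | side (a , b) y in sy
  ... | true  | true  = ⊥-elim (sep refl)
  ... | false | false = ⊥-elim (sep refl)
  ... | true  | false = crossing-edge-Θ ab xy sx sy
  ... | false | true  = crossing-edge-Θ ab (Adj-sym xy) sy sx ◅◅ (flip (Adj-sym xy) ◅ ε)

  record Crossing (e : Vertex × Vertex) (x z : Vertex) (m : ℕ) : Set where
    field
      {p q}  : Vertex
      pq     : Adj p q
      length : d x p + suc (d q z) ≤ m
      p-side : side e p ≡ side e x
      q-side : Separates e q x

  walk-crossing : ∀ e {x z m} → Walk Adj x z m → Separates e x z → Crossing e x z m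
  walk-crossing e here sep = ⊥-elim (sep refl)
  walk-crossing e {x} {z} {suc m} (step {y = x′} xx′ w) sep with side e x′ ≟ side e x
  ... | no x′-sep = record
    { pq = xx′
    ; length = subst (λ j → j + suc (d x′ z) ≤ suc m) (sym (d-refl x)) (s≤s (d-minimal w))
    ; p-side = refl
    ; q-side = x′-sep
    }
  ... | yes same = record
    { pq = pq
    ; length = ≤-trans (+-monoˡ-≤ (suc (d q z)) (subst (d x p ≤_) (cong (_+ d x′ p) (Adj⇒d≡1 xx′))
                                                                    (d-triangle x x′ p)))
                       (s≤s length)
    ; p-side = trans p-side same
    ; q-side = λ eq → q-side (trans eq (sym same))
    }
    where open Crossing (walk-crossing e w (λ eq → sep (trans (sym same) eq)))

  -- Let pq be the first edge of a geodesic from x to z that leaves the side of x. Then y is on p's side,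
  -- so d(y,q) = d(y,p) + 1, and the triangle inequality through z makes the geodesic from x to y too long.
  halfspace-convex : ∀ {a b x y z} → Adj a b → Between x z y → side (a , b) x ≡ side (a , b) y →
                     ¬ Separates (a , b) z x
  halfspace-convex {a} {b} {x} {y} {z} ab xzy sx≡sy sep = <-asym (+-cancelˡ-≤ X _ _ h₁) h₂
    where
    open Crossing (walk-crossing (a , b) (geodesic x z) (λ eq → sep (sym eq)))
    X Q Z P : ℕ
    X = d x p
    Q = d q z
    Z = d z y
    P = d p y
    dyq : d y q ≡ suc (d y p)
    dyq = side-true⇒d pq (trans (Θ-resp-≡side (separating-edge-Θ ab pq (λ eq → q-side (trans (sym eq) p-side)))
                                    (trans (sym sx≡sy) (sym p-side)))
                               (side-source pq))
    h₁ : X + suc (Q + Z) ≤ X + P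
    h₁ = begin
      X + suc (Q + Z)     ≡⟨ +-assoc X (suc Q) Z ⟨
      X + suc Q + Z       ≤⟨ +-monoˡ-≤ Z length ⟩
      d x z + Z           ≡⟨ xzy ⟩
      d x y               ≤⟨ d-triangle x p y ⟩
      X + P               ∎
      where open ≤-Reasoning
    h₂ : suc P ≤ Q + Z
    h₂ = begin
      suc P               ≡⟨ cong suc (d-sym p y) ⟩
      suc (d y p)         ≡⟨ dyq ⟨
      d y q               ≤⟨ d-triangle y z q ⟩
      d y z + d z q       ≡⟨ cong₂ _+_ (d-sym y z) (d-sym z q) ⟩
      Z + Q               ≡⟨ +-comm Z Q ⟩
      Q + Z               ∎
      where open ≤-Reasoning

  Between⇒¬separated-from-both : ∀ {x y z a b} → Between x z y → Adj a b →
                                 Separates (a , b) z x → Separates (a , b) z y → ⊥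
  Between⇒¬separated-from-both xzy ab s₁ s₂ = halfspace-convex ab xzy (≢-both⇒≡ s₁ s₂) s₁

  ¬separated-from-both⇒Between : ∀ {x y z} →
    (∀ {a b} → Adj a b → Separates (a , b) z x → Separates (a , b) z y → ⊥) → Between x z y
  ¬separated-from-both⇒Between {x} {y} {z} H with d z (med x y z) in eq
  ... | zero  = subst (λ t → Between x t y) (sym (d≡0⇒≡ eq)) (med-between₁ x y z)
  ... | suc k = ⊥-elim (H zz′ (separated (med-between₃ x y z)) (separated (Between-sym (med-between₂ x y z))))
    where
    m : Vertex
    m = med x y z
    z′ : Vertex
    z′ = proj₁ (step-toward eq)
    zz′ : Adj z z′
    zz′ = proj₁ (proj₂ (step-toward eq))
    m-side : side (z , z′) m ≡ false
    m-side = side-false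
      (subst₂ _<_ (trans (sym (proj₂ (proj₂ (step-toward eq)))) (d-sym z′ m)) (trans (sym eq) (d-sym z m)) ≤-refl)
    m-sep : Separates (z , z′) m z
    m-sep eq′ with trans (sym (side-source zz′)) (trans (sym eq′) m-side)
    ... | ()
    separated : ∀ {w} → Between z m w → Separates (z , z′) z w
    separated zmw same = halfspace-convex zz′ zmw same m-sep

  ConnAvoid-++ : ∀ {e x y z} → ConnAvoid Adj e x y → ConnAvoid Adj e y z → ConnAvoid Adj e x z
  ConnAvoid-++ here           r = r
  ConnAvoid-++ (step xy ¬θ p) r = step xy ¬θ (ConnAvoid-++ p r)

  ConnAvoid-reverse : ∀ {e x y} → ConnAvoid Adj e x y → ConnAvoid Adj e y x
  ConnAvoid-reverse here = here
  ConnAvoid-reverse (step xy ¬θ p) =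
    ConnAvoid-++ (ConnAvoid-reverse p) (step (Adj-sym xy) (λ θ → ¬θ (θ ◅◅ (flip (Adj-sym xy) ◅ ε))) here)

  ConnAvoid-resp-Θ : ∀ {e f x y} → Θ Adj e f → ConnAvoid Adj e x y → ConnAvoid Adj f x y
  ConnAvoid-resp-Θ θ here           = here
  ConnAvoid-resp-Θ θ (step xy ¬θ p) = step xy (λ θ′ → ¬θ (θ ◅◅ θ′)) (ConnAvoid-resp-Θ θ p)

  toward-source : ∀ {a b w} → Adj a b → side (a , b) w ≡ true → ConnAvoid Adj (a , b) w a
  toward-source {a} {b} ab = by-distance (d _ a) refl
    where
    by-distance : ∀ k {w} → d w a ≡ k → side (a , b) w ≡ true → ConnAvoid Adj (a , b) w a
    by-distance zero    dwa _ = subst (λ t → ConnAvoid Adj (a , b) t a) (sym (d≡0⇒≡ dwa)) here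
    by-distance (suc k) {w} dwa sw =
      step ww′ (λ θ → Θ-edge-separates θ ww′ (trans sw (sym sw′))) (by-distance k dw′a sw′)
      where
      w′ : Vertex
      w′ = proj₁ (step-toward dwa)
      ww′ : Adj w w′
      ww′ = proj₁ (proj₂ (step-toward dwa))
      dw′a : d w′ a ≡ k
      dw′a = proj₂ (proj₂ (step-toward dwa))
      sw′ : side (a , b) w′ ≡ true
      sw′ = side-true (subst (_< d w′ b) (sym dw′a)
              (≤-pred (subst (_≤ suc (d w′ b)) (trans (side-true⇒d ab sw) (cong suc dwa))
                                               (d-step-≤′ b (Adj-sym ww′)))))

  ¬Separates⇒ConnAvoid : ∀ {a b x y} → Adj a b → ¬ Separates (a , b) x y → ConnAvoid Adj (a , b) x y
  ¬Separates⇒ConnAvoid {a} {b} {x} {y} ab ¬sep with side (a , b) x in sx | ¬Separates⇒≡ ¬sep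
  ... | true  | sy = ConnAvoid-++ (toward-source ab sx) (ConnAvoid-reverse (toward-source ab (sym sy)))
  ... | false | sy = ConnAvoid-resp-Θ (flip (Adj-sym ab) ◅ ε)
      (ConnAvoid-++ (toward-source (Adj-sym ab) (trans (side-swap ab x) (cong not sx)))
                    (ConnAvoid-reverse (toward-source (Adj-sym ab) (trans (side-swap ab y) (cong not (sym sy))))))

  Separates⇒¬ConnAvoid : ∀ {a b x y} → Adj a b → Separates (a , b) x y → ¬ ConnAvoid Adj (a , b) x y
  Separates⇒¬ConnAvoid ab sep here = sep refl
  Separates⇒¬ConnAvoid {a} {b} ab sep (step {x} {y} xy ¬θ p) with side (a , b) x ≟ side (a , b) y
  ... | no  x-sep = ¬θ (separating-edge-Θ ab xy x-sep)
  ... | yes same  = Separates⇒¬ConnAvoid ab (λ eq → sep (trans same eq)) p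

  InSignature⇒Separates : ∀ {x y a b} → InSignature Adj x y (a , b) → Separates (a , b) x y
  InSignature⇒Separates (ab , ¬conn) sep = ¬conn (¬Separates⇒ConnAvoid ab (λ s → s sep))

  Separates⇒InSignature : ∀ {x y a b} → Adj a b → Separates (a , b) x y → InSignature Adj x y (a , b)
  Separates⇒InSignature ab sep = ab , Separates⇒¬ConnAvoid ab sep

  Separates-source⇒false : ∀ {a b w} → Adj a b → Separates (a , b) a w → side (a , b) w ≡ false
  Separates-source⇒false ab sep = trans (¬-not (λ eq → sep (sym eq))) (cong not (side-source ab))

  ¬Separates-source⇒true : ∀ {a b w} → Adj a b → ¬ Separates (a , b) a w → side (a , b) w ≡ true
  ¬Separates-source⇒true ab ¬sep = trans (sym (¬Separates⇒≡ ¬sep)) (side-source ab)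

  Θ-distinct-at-vertex : ∀ {x p q} → Adj x p → Adj x q → p ≢ q → ¬ Θ Adj (x , p) (x , q)
  Θ-distinct-at-vertex {x} {p} {q} xp xq p≢q θ =
    halfspace-convex xp pxq (trans (side-target xp) (sym sq)) (Θ-edge-separates ε xp)
    where
    sq : side (x , p) q ≡ false
    sq = Separates-source⇒false xp (Θ-edge-separates θ xq)
    pxq : Between p x q
    pxq = Between-by-distances (Adj⇒d≡1′ xp) (Adj⇒d≡1 xq) (distinct-neighbours-d≡2 xp xq p≢q) refl

  false-side-convex : ∀ {a b u t w} → Adj a b → Between u t w →
                      side (a , b) u ≡ false → side (a , b) w ≡ false → side (a , b) t ≡ false
  false-side-convex ab utw su sw = trans (¬Separates⇒≡ (halfspace-convex ab utw (trans su (sym sw)))) su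

  -- The fourth corner r is the median of p, q and y.
  square-completion : ∀ {x p q y} → Adj x p → Adj x q → ¬ Θ Adj (x , p) (x , q) →
                      Separates (x , p) x y → Separates (x , q) x y → ∃[ r ] Cycle4 Adj x p r q
  square-completion {x} {p} {q} {y} xp xq ¬θ yp yq = corner (d p m) refl
    where
    m : Vertex
    m = med p q y
    p≢q : p ≢ q
    p≢q refl = ¬θ ε
    sp : side (x , q) p ≡ true
    sp = ¬Separates-source⇒true xq (λ sep → ¬θ (Θ-sym (separating-edge-Θ xq xp sep)))
    sq : side (x , p) q ≡ true
    sq = ¬Separates-source⇒true xp (λ sep → ¬θ (separating-edge-Θ xp xq sep))
    pmq : d p m + d m q ≡ 2
    pmq = trans (med-between₁ p q y) (distinct-neighbours-d≡2 xp xq p≢q)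
    true≢false : true ≢ false
    true≢false ()
    corner : ∀ j → d p m ≡ j → ∃[ r ] Cycle4 Adj x p r q
    corner zero dpm = ⊥-elim (true≢false (trans (sym sp)
      (false-side-convex xq (subst (λ t → Between q t y) (sym (d≡0⇒≡ dpm)) (med-between₂ p q y))
        (side-target xq) (Separates-source⇒false xq yq))))
    corner (suc zero) dpm = m , xp , d≡1⇒Adj dpm , d≡1⇒Adj dmq , Adj-sym xq , x≢m , p≢q
      where
      dmq : d m q ≡ 1
      dmq = suc-injective (trans (cong (_+ d m q) (sym dpm)) pmq)
      x≢m : x ≢ m
      x≢m x≡m = true≢false (trans (sym (side-source xp))
        (false-side-convex xp (subst (λ t → Between y t p) (sym x≡m) (med-between₃ p q y))
          (Separates-source⇒false xp yp) (side-target xp)))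
    corner (suc (suc k)) dpm = ⊥-elim (true≢false (trans (sym sq)
      (false-side-convex xp (subst (λ t → Between y t p) m≡q (med-between₃ p q y))
        (Separates-source⇒false xp yp) (side-target xp))))
      where
      m≡q : m ≡ q
      m≡q = d≡0⇒≡ (m+n≡0⇒n≡0 k (suc-injective (suc-injective (trans (cong (_+ d m q) (sym dpm)) pmq))))

  Cycle4⇒Orth : ∀ {u v y x} → Cycle4 Adj u v y x → Orth Adj (u , v) (u , x)
  Cycle4⇒Orth c = _ , _ , _ , _ , c , ε , (θ₀ c ◅ ε) , ε , (θ₀ (Cycle4-transpose c) ◅ ε)

  Orth-sym : ∀ {e f} → Orth Adj e f → Orth Adj f e
  Orth-sym (u , v , y , x , c , θ₁ , θ₂ , θ₃ , θ₄) =
    u , x , y , v , Cycle4-transpose c , θ₃ , θ₄ , θ₁ , θ₂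

  Orth-resp-Θ : ∀ {e e′ f f′} → Θ Adj e e′ → Θ Adj f f′ → Orth Adj e f → Orth Adj e′ f′
  Orth-resp-Θ θe θf (u , v , y , x , c , θ₁ , θ₂ , θ₃ , θ₄) =
    u , v , y , x , c , Θ-sym θe ◅◅ θ₁ , Θ-sym θe ◅◅ θ₂ , Θ-sym θf ◅◅ θ₃ , Θ-sym θf ◅◅ θ₄

  Orth⇒opposite-quadrant : ∀ {a b c c′} → Adj a b → Orth Adj (a , b) (c , c′) → ¬ Θ Adj (a , b) (c , c′) →
                           ∀ z → ∃[ y ] (Separates (a , b) z y × Separates (c , c′) z y)
  Orth⇒opposite-quadrant {a} {b} {c} {c′} ab
    (u , v , y , x , (uv , vy , yx , xu , _) , θ₁ , θ₂ , θ₃ , θ₄) ¬θ z =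
    quadrant (side e z ≟ side e u) (side f z ≟ side f u) (side f z ≟ side f v)
    where
    e f : Vertex × Vertex
    e = (a , b)
    f = (c , c′)
    euv : Separates e u v
    euv = Θ-edge-separates θ₁ uv
    fux : Separates f u x
    fux = Θ-edge-separates θ₃ (Adj-sym xu)
    fvy : Separates f v y
    fvy = Θ-edge-separates θ₄ vy
    eux : side e u ≡ side e x
    eux = ¬Separates⇒≡ (λ sep → ¬θ (separating-edge-Θ ab (Adj-sym xu) sep ◅◅ Θ-sym θ₃))
    evy : side e v ≡ side e y
    evy = ¬Separates⇒≡ (λ sep → ¬θ (separating-edge-Θ ab vy sep ◅◅ Θ-sym θ₄))
    quadrant : Dec (side e z ≡ side e u) → Dec (side f z ≡ side f u) → Dec (side f z ≡ side f v) →
               ∃[ w ] (Separates e z w × Separates f z w)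
    quadrant (no zu)  (no zu′)  _         = u , zu , zu′
    quadrant (no zu)  (yes zu′) _         = x , (λ eq → zu (trans eq (sym eux))) , (λ eq → fux (trans (sym zu′) eq))
    quadrant (yes zu) _         (no zv′)  = v , (λ eq → euv (trans (sym zu) eq)) , zv′
    quadrant (yes zu) _         (yes zv′) =
      y , (λ eq → euv (trans (sym zu) (trans eq (sym evy)))) , (λ eq → fvy (trans (sym zv′) eq))

  EdgeAt : Vertex × Vertex → Vertex → Set
  EdgeAt e x = ∃[ w ] (Adj x w × Θ Adj e (x , w))

  module Cube {k : ℕ} (φ : Vec Bool k → Vertex) (induced : IsInducedCube Adj φ) (a₀ : Vec Bool k) where

    φ-≢ : ∀ {b c} → b ≢ c → φ b ≢ φ c
    φ-≢ {b} {c} b≢c eq = b≢c (proj₁ induced b c eq)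

    cube-edge : ∀ b i → Adj (φ b) (φ (flipAt i b))
    cube-edge b i = Equivalence.from (proj₂ induced b (flipAt i b)) (i , refl)

    axis : Fin k → Vertex × Vertex
    axis i = (φ a₀ , φ (flipAt i a₀))

    ParallelToAxes : Vec Bool k → Set
    ParallelToAxes c = ∀ i → Θ Adj (axis i) (φ c , φ (flipAt i c))

    cube-edge-Θ-axis : ∀ b → ParallelToAxes b
    cube-edge-Θ-axis b = flipAt-induction ParallelToAxes flipAt-step a₀ b (λ _ → ε)
      where
      flipAt-step : ∀ c j → ParallelToAxes c → ParallelToAxes (flipAt j c)
      flipAt-step c j θ i with i ≟ᶠ j
      ... | yes refl = subst (λ t → Θ Adj (axis i) (φ (flipAt i c) , φ t)) (sym (flipAt-involutive i c))
                             (θ i ◅◅ (flip (cube-edge c i) ◅ ε))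
      ... | no i≢j = subst (λ t → Θ Adj (axis i) (φ (flipAt j c) , φ t)) (flipAt-comm (λ eq → i≢j (sym eq)) c)
                           (θ i ◅◅ (θ₀ square ◅ ε))
        where
        square : Cycle4 Adj (φ c) (φ (flipAt i c)) (φ (flipAt j (flipAt i c))) (φ (flipAt j c))
        square = cube-edge c i , cube-edge (flipAt i c) j
               , Adj-sym (subst (λ t → Adj (φ (flipAt j c)) (φ t)) (flipAt-comm i≢j c) (cube-edge (flipAt j c) i))
               , Adj-sym (cube-edge c j) , φ-≢ (≢-flipAt-flipAt i≢j c) , φ-≢ (flipAt-≢-flipAt i≢j c)

    cube-edge-Θ-distinct : ∀ b {i j} → i ≢ j → ¬ Θ Adj (φ b , φ (flipAt i b)) (φ b , φ (flipAt j b))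
    cube-edge-Θ-distinct b i≢j = Θ-distinct-at-vertex (cube-edge b _) (cube-edge b _) (φ-≢ (flipAt-≢-flipAt i≢j b))

    -- Moving along direction j flips both the side of axis i and coordinate i when j = i, and neither otherwise.
    axis-side-invariant : ∀ i b c → side (axis i) (φ b) xor lookup b i ≡ side (axis i) (φ c) xor lookup c i
    axis-side-invariant i b c =
      flipAt-induction (λ c → invariant b ≡ invariant c) (λ c j eq → trans eq (sym (flipAt-step c j))) b c refl
      where
      invariant : Vec Bool k → Bool
      invariant c = side (axis i) (φ c) xor lookup c i
      flipAt-step : ∀ c j → invariant (flipAt j c) ≡ invariant c
      flipAt-step c j with i ≟ᶠ j
      ... | yes refl = begin
        side (axis i) (φ (flipAt i c)) xor lookup (flipAt i c) i
          ≡⟨ cong₂ _xor_ (¬-not (λ eq → Θ-edge-separates (cube-edge-Θ-axis c i) (cube-edge c i) (sym eq)))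
                         (lookup∘updateAt i c) ⟩
        not (side (axis i) (φ c)) xor not (lookup c i)
          ≡⟨ xor-annihilates-not (side (axis i) (φ c)) (lookup c i) ⟩
        side (axis i) (φ c) xor lookup c i
          ∎
        where open ≡-Reasoning
      ... | no i≢j = cong₂ _xor_ (sym (¬Separates⇒≡ same-side)) (lookup∘updateAt′ i j i≢j c)
        where
        same-side : ¬ Separates (axis i) (φ c) (φ (flipAt j c))
        same-side sep = cube-edge-Θ-distinct c i≢j
          (Θ-sym (cube-edge-Θ-axis c i) ◅◅ separating-edge-Θ (cube-edge a₀ i) (cube-edge c j) sep)

    axis-separates : ∀ {i b c} → lookup b i ≢ lookup c i → Separates (axis i) (φ b) (φ c)
    axis-separates {i} {b} {c} b≢c eq =
      b≢c (xor-cancelˡ (side (axis i) (φ b)) _ _ (trans (axis-side-invariant i b c) (cong (_xor lookup c i) (sym eq))))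

    axis-same-side : ∀ {i b c} → lookup b i ≡ lookup c i → side (axis i) (φ b) ≡ side (axis i) (φ c)
    axis-same-side {i} {b} {c} b≡c =
      xor-cancelʳ _ _ (lookup c i) (trans (cong (side (axis i) (φ b) xor_) (sym b≡c)) (axis-side-invariant i b c))

    -- An edge in a class orthogonal to every axis is carried along each cube edge by completing a square.
    module _ {a b} (ab : Adj a b) (orth : ∀ i → Orth Adj (a , b) (axis i))
             (¬θ : ∀ i → ¬ Θ Adj (a , b) (axis i)) where

      EdgeAt-flipAt : ∀ c i → EdgeAt (a , b) (φ c) → EdgeAt (a , b) (φ (flipAt i c))
      EdgeAt-flipAt c i (w , xw , θ) = r , Adj-sym (proj₁ (proj₂ (proj₂ square))) , θ ◅◅ (θ₀ square ◅ ε)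
        where
        x q : Vertex
        x = φ c
        q = φ (flipAt i c)
        ¬θ′ : ¬ Θ Adj (x , w) (x , q)
        ¬θ′ θ′ = ¬θ i (θ ◅◅ θ′ ◅◅ Θ-sym (cube-edge-Θ-axis c i))
        opposite : ∃[ y ] (Separates (a , b) x y × Separates (axis i) x y)
        opposite = Orth⇒opposite-quadrant ab (orth i) (¬θ i) x
        completion : ∃[ r ] Cycle4 Adj x w r q
        completion = square-completion xw (cube-edge c i) ¬θ′
                       (Θ-resp-Separates θ (proj₁ (proj₂ opposite)))
                       (Θ-resp-Separates (cube-edge-Θ-axis c i) (proj₂ (proj₂ opposite)))
        r : Vertex
        r = proj₁ completion
        square : Cycle4 Adj x w r q
        square = proj₂ completion

      EdgeAt-cube : ∀ c₁ c₂ → EdgeAt (a , b) (φ c₁) → EdgeAt (a , b) (φ c₂)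
      EdgeAt-cube = flipAt-induction (λ c → EdgeAt (a , b) (φ c)) EdgeAt-flipAt

    module Signature (L : Vertex × Vertex → Set) (classSet : IsClassSet Adj L) (signature : CubeSignature Adj φ L) where

      L⇒Θ-axis : ∀ {e} → L e → ∃[ i ] Θ Adj e (axis i)
      L⇒Θ-axis {e} le with Equivalence.to (signature e) le
      ... | c , _ , (i , refl) , θ = i , θ ◅◅ Θ-sym (cube-edge-Θ-axis c i)

      L-axis : ∀ i → L (axis i)
      L-axis i = Equivalence.from (signature (axis i)) (a₀ , flipAt i a₀ , (i , refl) , ε)

      ¬L⇒¬Θ-axis : ∀ {e} → ¬ L e → ∀ i → ¬ Θ Adj e (axis i)
      ¬L⇒¬Θ-axis ¬le i θ = ¬le (proj₂ classSet _ _ (Θ-sym θ) (L-axis i))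

      separating-cube-vertices⇒L : ∀ {a b} → Adj a b → ∀ c₁ c₂ → Separates (a , b) (φ c₁) (φ c₂) →
                                   L (a , b)
      separating-cube-vertices⇒L {a} {b} ab c₁ c₂ =
        flipAt-induction (λ c → Separates (a , b) (φ c₁) (φ c) → L (a , b)) flipAt-step c₁ c₂
                         (λ sep → ⊥-elim (sep refl))
        where
        flipAt-step : ∀ c j → (Separates (a , b) (φ c₁) (φ c) → L (a , b)) →
                      Separates (a , b) (φ c₁) (φ (flipAt j c)) → L (a , b)
        flipAt-step c j ih sep with side (a , b) (φ c₁) ≟ side (a , b) (φ c)
        ... | no  c-sep = ih c-sep
        ... | yes same  = Equivalence.from (signature (a , b))
                            (c , flipAt j c , (j , refl) , separating-edge-Θ ab (cube-edge c j) (λ eq → sep (trans same eq)))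

      POF-extend : ∀ {e} → IsPOF Adj L → (∀ i → Orth Adj e (axis i)) → IsPOF Adj (λ f → L f ⊎ Θ Adj e f)
      POF-extend pof orth f g (inj₁ lf) (inj₁ lg) ¬θ = pof f g lf lg ¬θ
      POF-extend pof orth f g (inj₂ θf) (inj₂ θg) ¬θ = ⊥-elim (¬θ (Θ-sym θf ◅◅ θg))
      POF-extend pof orth f g (inj₂ θf) (inj₁ lg) ¬θ with L⇒Θ-axis lg
      ... | i , θg = Orth-resp-Θ θf (Θ-sym θg) (orth i)
      POF-extend pof orth f g (inj₁ lf) (inj₂ θg) ¬θ with L⇒Θ-axis lf
      ... | i , θf = Orth-sym (Orth-resp-Θ θg (Θ-sym θf) (orth i))

  module Ladder (v₀ : Vertex) (L : Vertex × Vertex → Set) (classSet : IsClassSet Adj L) (pof : IsPOF Adj L)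
                {k : ℕ} (φ : Vec Bool k → Vertex) (induced : IsInducedCube Adj φ) (signature : CubeSignature Adj φ L)
                (a₀ a⁺ : Vec Bool k) (out : Outgoing Adj v₀ (φ a₀) L) (anti : IsAntiBasis Adj v₀ φ a⁺) where
    open Cube φ induced a₀
    open Signature L classSet signature

    u u⁺ : Vertex
    u  = φ a₀
    u⁺ = φ a⁺

    v₀-side-axis : ∀ i → side (axis i) v₀ ≡ side (axis i) u
    v₀-side-axis i with out (axis i) (L-axis i)
    ... | w , uw , θ , (_ , _ , D₁ , D₂ , lt) = Θ-resp-≡side (Θ-sym θ)
      (trans (side-true (subst₂ _<_ (Dist⇒≡d D₁) (Dist⇒≡d D₂) lt)) (sym (side-source uw)))

    anti-basis-opposite : ∀ i → lookup a⁺ i ≢ lookup a₀ i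
    anti-basis-opposite i eq = <⇒≱ (≤-reflexive (sym farther))
      (anti (flipAt i a⁺) _ _ (d-Dist v₀ (φ (flipAt i a⁺))) (d-Dist v₀ u⁺))
      where
      farther : d v₀ (φ (flipAt i a⁺)) ≡ suc (d v₀ u⁺)
      farther = side-true⇒d (cube-edge a⁺ i) (trans
        (Θ-resp-≡side (cube-edge-Θ-axis a⁺ i) (trans (v₀-side-axis i) (sym (axis-same-side eq))))
        (side-source (cube-edge a⁺ i)))

    L⇒Separates-u-u⁺ : ∀ {e} → L e → Separates e u u⁺
    L⇒Separates-u-u⁺ le with L⇒Θ-axis le
    ... | i , θ = Θ-resp-Separates (Θ-sym θ) (axis-separates (λ eq → anti-basis-opposite i (sym eq)))

    Separates-u-u⁺⇒L : ∀ {a b} → Adj a b → Separates (a , b) u u⁺ → L (a , b)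
    Separates-u-u⁺⇒L ab = separating-cube-vertices⇒L ab a₀ a⁺

    L⇒side-u≡side-v₀ : ∀ {e} → L e → side e u ≡ side e v₀
    L⇒side-u≡side-v₀ le with L⇒Θ-axis le
    ... | i , θ = Θ-resp-≡side (Θ-sym θ) (sym (v₀-side-axis i))

    LadderIs : Vertex → Set
    LadderIs v = ∀ e → InLadder Adj u v e ⇔ L e

    NoPOFExtension : Vertex → Set
    NoPOFExtension v = ∀ e → InLadder Adj u⁺ v e → ¬ IsPOF Adj (λ f → L f ⊎ Θ Adj e f)

    ladder⇒L-separates : ∀ {v a b} → LadderIs v → L (a , b) → Separates (a , b) u v
    ladder⇒L-separates ladder le = InSignature⇒Separates (proj₁ (Equivalence.from (ladder _) le))

    ladder⇒u⁺-between : ∀ {v} → Between v₀ u v → LadderIs v → Between v₀ u⁺ v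
    ladder⇒u⁺-between {v} u-between ladder = ¬separated-from-both⇒Between separated
      where
      separated : ∀ {a b} → Adj a b → Separates (a , b) u⁺ v₀ → Separates (a , b) u⁺ v → ⊥
      separated {a} {b} ab s₁ s₂ with side (a , b) u ≟ side (a , b) u⁺
      ... | no  u-u⁺ = s₂ (≢-both⇒≡ u-u⁺ (ladder⇒L-separates ladder (Separates-u-u⁺⇒L ab u-u⁺)))
      ... | yes same = Between⇒¬separated-from-both u-between ab
                         (λ eq → s₁ (trans (sym same) eq)) (λ eq → s₂ (trans (sym same) eq))

    ladder⇒no-POF-extension : ∀ {v} → LadderIs v → NoPOFExtension v
    ladder⇒no-POF-extension {v} ladder (a , b) (sig@(ab , _) , edge) pof′ =
      ¬le (Equivalence.to (ladder (a , b))
            (Separates⇒InSignature ab u-v , EdgeAt-cube ab orth (¬L⇒¬Θ-axis ¬le) a⁺ a₀ edge))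
      where
      u⁺-v : Separates (a , b) u⁺ v
      u⁺-v = InSignature⇒Separates sig
      ¬le : ¬ L (a , b)
      ¬le le = u⁺-v (≢-both⇒≡ (L⇒Separates-u-u⁺ le) (ladder⇒L-separates ladder le))
      u-v : Separates (a , b) u v
      u-v eq = u⁺-v (trans (sym (¬Separates⇒≡ (¬le ∘ Separates-u-u⁺⇒L ab))) eq)
      orth : ∀ i → Orth Adj (a , b) (axis i)
      orth i = pof′ (a , b) (axis i) (inj₂ ε) (inj₁ (L-axis i)) (¬L⇒¬Θ-axis ¬le i)

    u⁺-between⇒u-between : ∀ {v} → Between v₀ u⁺ v → Between v₀ u v
    u⁺-between⇒u-between {v} u⁺-between = ¬separated-from-both⇒Between separated
      where
      separated : ∀ {a b} → Adj a b → Separates (a , b) u v₀ → Separates (a , b) u v → ⊥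
      separated {a} {b} ab s₁ s₂ with side (a , b) u ≟ side (a , b) u⁺
      ... | no  u-u⁺ = s₁ (L⇒side-u≡side-v₀ (Separates-u-u⁺⇒L ab u-u⁺))
      ... | yes same = Between⇒¬separated-from-both u⁺-between ab
                         (λ eq → s₁ (trans same eq)) (λ eq → s₂ (trans same eq))

    u⁺-between⇒L-separates : ∀ {v e} → Between v₀ u⁺ v → L e → Separates e u v
    u⁺-between⇒L-separates {v} {a , b} u⁺-between le eq = L⇒Separates-u-u⁺ le (trans eq (sym u⁺≡v))
      where
      u⁺-v₀ : Separates (a , b) u⁺ v₀
      u⁺-v₀ eq′ = L⇒Separates-u-u⁺ le (trans (L⇒side-u≡side-v₀ le) (sym eq′))
      u⁺≡v : side (a , b) u⁺ ≡ side (a , b) v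
      u⁺≡v = ¬Separates⇒≡ (Between⇒¬separated-from-both u⁺-between (proj₁ classSet _ le) u⁺-v₀)

    u⁺-between⇒L⊆ladder : ∀ {v e} → Between v₀ u⁺ v → L e → InLadder Adj u v e
    u⁺-between⇒L⊆ladder {e = a , b} u⁺-between le with out (a , b) le
    ... | w , uw , θ , _ = Separates⇒InSignature ab (u⁺-between⇒L-separates u⁺-between le) , w , uw , θ
      where
      ab : Adj a b
      ab = proj₁ classSet _ le

    -- An edge of the ladder outside L spans a square with every axis at u, so its class is orthogonal to L
    -- and reappears at u⁺, contradicting the absence of POF extensions.
    no-POF-extension⇒ladder⊆L : ∀ {v e} → Between v₀ u⁺ v → NoPOFExtension v → InLadder Adj u v e → L e
    no-POF-extension⇒ladder⊆L {v} {a , b} u⁺-between no-extension (sig@(ab , _) , edge@(w , uw , θ))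
      with side (a , b) u ≟ side (a , b) u⁺
    ... | no  u-u⁺ = Separates-u-u⁺⇒L ab u-u⁺
    ... | yes same = ⊥-elim (no-extension (a , b)
                       (Separates⇒InSignature ab (λ eq → u-v (trans same eq)) , EdgeAt-cube ab orth ¬θ a₀ a⁺ edge)
                       (POF-extend pof orth))
      where
      u-v : Separates (a , b) u v
      u-v = InSignature⇒Separates sig
      ¬θ : ∀ i → ¬ Θ Adj (a , b) (axis i)
      ¬θ = ¬L⇒¬Θ-axis (λ le → L⇒Separates-u-u⁺ le same)
      orth : ∀ i → Orth Adj (a , b) (axis i)
      orth i = Orth-resp-Θ (Θ-sym θ) ε (Cycle4⇒Orth (proj₂
        (square-completion uw (cube-edge a₀ i) (λ θ′ → ¬θ i (θ ◅◅ θ′))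
          (Θ-resp-Separates θ u-v) (u⁺-between⇒L-separates u⁺-between (L-axis i)))))

theorem5 : ∀ {n} (Adj : Fin n → Fin n → Set) → IsMedianGraph Adj →
  (v₀ u : Fin n) (L : Fin n × Fin n → Set) →
  IsClassSet Adj L → IsPOF Adj L → Outgoing Adj v₀ u L →
  (k : ℕ) (φ : Vec Bool k → Fin n) → IsHypercubeWith Adj v₀ u L φ →
  (a⁺ : Vec Bool k) → IsAntiBasis Adj v₀ φ a⁺ →
  (v : Fin n) → v ≢ φ a⁺ →
  ((InI Adj v₀ v u × (∀ e → InLadder Adj u v e ⇔ L e))
    ⇔ (InI Adj v₀ v (φ a⁺)
       × (∀ e → InLadder Adj (φ a⁺) v e → ¬ IsPOF Adj (λ f → L f ⊎ Θ Adj e f))))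
theorem5 Adj median v₀ _ L classSet pof out k φ (induced , signature , a₀ , refl , _) a⁺ anti v _ =
  mk⇔ (λ (u∈I , ladder) →
         Between⇒InI (ladder⇒u⁺-between (InI⇒Between u∈I) ladder) , ladder⇒no-POF-extension ladder)
      (λ (u⁺∈I , no-extension) →
         let u⁺-between = InI⇒Between u⁺∈I in
         Between⇒InI (u⁺-between⇒u-between u⁺-between) ,
         λ e → mk⇔ (no-POF-extension⇒ladder⊆L u⁺-between no-extension) (u⁺-between⇒L⊆ladder u⁺-between))
  where
  open MedianGraph Adj median
  open Ladder v₀ L classSet pof φ induced signature a₀ a⁺ out anti
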